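{- Let $\Delta, m_1, m_2$ be positive integers, $T$ a forest with $\Delta(T)\leq\Delta$, and $G$ a graph with $|G|\geq|T|+13\Delta m_1+m_2$ such that the complement $G^c$ does not contain $K_{m_1,m_2}$. Then $G$ contains a copy of $T$. Additionally, this copy can be chosen so that for all $S\subseteq T$ (subsets of the vertex set of the copy) with $|S|\leq m_1$, we have $|N(S)\setminus T|\geq\Delta|S|$.
   Context: For a graph $G$ and $S\subseteq V(G)$, $N(S)=\bigcup_{x\in S}N_G(x)\setminus S$. $K_{m_1,m_2}$ is the complete bipartite graph with parts of sizes $m_1,m_2$. $G^c$ is the complement of $G$. $\Delta(T)$ is the maximum degree of $T$; $|G|$ is the number of vertices. -}

module Defs where

open import Data.Nat using (ℕ; zero; suc; _+_; _*_; _≤_)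
open import Data.Bool using (Bool; true; false; _∧_; _∨_; not)
open import Data.Fin using (Fin; zero; suc; inject₁; fromℕ; _≟_)
open import Data.Fin.Subset using (Subset; ∣_∣)
open import Data.Vec using (tabulate; lookup)
open import Data.Product using (Σ; _×_; _,_)
open import Function.Definitions using (Injective)
open import Relation.Binary.PropositionalEquality using (_≡_; _≢_)
open import Relation.Nullary.Decidable using (⌊_⌋)

record Graph (n : ℕ) : Set where
  field
    adj    : Fin n → Fin n → Bool
    sym    : ∀ u v → adj u v ≡ adj v u
    irrefl : ∀ v → adj v v ≡ false
open Graph public

Edge : ∀ {n} → Graph n → Fin n → Fin n → Set
Edge G u v = adj G u v ≡ true

anyFin : ∀ {k} → (Fin k → Bool) → Bool
anyFin {zero}  p = false
anyFin {suc k} p = p zero ∨ anyFin (λ i → p (suc i))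

degree : ∀ {n} → Graph n → Fin n → ℕ
degree G v = ∣ tabulate (adj G v) ∣

MaxDegree≤ : ∀ {n} → Graph n → ℕ → Set
MaxDegree≤ G d = ∀ v → degree G v ≤ d

HasCycle : ∀ {n} → Graph n → Set
HasCycle {n} G = Σ ℕ λ k → Σ (Fin (3 + k) → Fin n) λ c →
  Injective _≡_ _≡_ c ×
  (∀ (i : Fin (2 + k)) → Edge G (c (inject₁ i)) (c (suc i))) ×
  Edge G (c (fromℕ (2 + k))) (c zero)

IsForest : ∀ {n} → Graph n → Set
IsForest G = HasCycle G → Data.Empty.⊥
  where import Data.Empty

record Embedding {t n : ℕ} (T : Graph t) (G : Graph n) : Set where
  field
    map      : Fin t → Fin n
    injective : Injective _≡_ _≡_ map
    edges    : ∀ u v → Edge T u v → Edge G (map u) (map v)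
open Embedding public

ComplementContainsK : ∀ {n} → Graph n → ℕ → ℕ → Set
ComplementContainsK {n} G m₁ m₂ =
  Σ (Fin m₁ → Fin n) λ A → Σ (Fin m₂ → Fin n) λ B →
    Injective _≡_ _≡_ A × Injective _≡_ _≡_ B ×
    (∀ i j → A i ≢ B j) × (∀ i j → adj G (A i) (B j) ≡ false)

-- For a copy f of T in G and S ⊆ V(T) (identified with its image f(S)),
-- the set N(S) ∖ V(copy of T) as a subset of V(G).
NbhdOutside : ∀ {t n} {T : Graph t} {G : Graph n} → Embedding T G → Subset t → Subset n
NbhdOutside {G = G} f S = tabulate λ v →
  not (anyFin (λ u → ⌊ map f u ≟ v ⌋)) ∧ anyFin (λ u → lookup S u ∧ adj G (map f u) v)

-- The forest is embedded greedily, one vertex at a time, each new vertex having at most one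
-- already embedded neighbour (every nonempty vertex set of a forest contains such a vertex, since
-- otherwise a non-backtracking walk inside the set closes a cycle). The used set I consists of
-- the image so far together with a set B of fewer than m₁ badly expanding vertices, and the
-- invariant is that every S with |S| ≤ 2m₁ satisfies 2Δ|S| ≤ |N(S) ∖ I| + w(S), where the weight
-- of an embedded vertex counts its tree-neighbours already embedded and each vertex of B weighs 2Δ.
-- Call S tight when this inequality is not strict. As S ↦ |N(S) ∖ I| is submodular, the union of
-- two tight sets is tight, so a largest small tight set M contains all of them; the next image is
-- chosen outside I ∪ M ∪ N(M), next to the parent's image if there is a parent, and then every
-- set keeps the invariant. The complement hypothesis says that every m₁-set X leaves fewer than
-- m₂ vertices outside X ∪ N(X); with |G| ≥ |T| + 13Δm₁ + m₂ this keeps tight sets below m₁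
-- vertices and leaves room for the next image. At the end all weights are at most Δ, so the
-- invariant yields |N(S) ∖ T| ≥ Δ|S|.

module Submission where

open import Defs renaming (sym to adj-sym)
open import Data.Nat using (ℕ; suc; _+_; _*_; _≤_)
open import Data.Fin.Subset using (Subset; ∣_∣)
open import Data.Product using (Σ)
open import Relation.Nullary using (¬_)

open import Data.Nat using (zero; _<_; z≤n; s≤s; _≤?_; _<?_) renaming (_≟_ to _≟ℕ_)
open import Data.Nat.Properties hiding (_≟_; suc-injective)
import Data.Nat.Properties as ℕₚ
open import Data.Nat.Tactic.RingSolver using (solve-∀)
open import Algebra.Properties.CommutativeMonoid.Sum +-0-commutativeMonoid using (sum; ∑-distrib-+; sum-cong-≗)
open import Algebra.Properties.Semiring.Sum +-*-semiring using (*-distribˡ-sum; *-distribʳ-sum)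
open import Algebra.Properties.CommutativeSemigroup +-commutativeSemigroup using (interchange)
open import Data.Bool using (Bool; true; false; _∧_; _∨_; not; if_then_else_)
open import Data.Bool.Properties
  using ( ∧-identityʳ; ∨-identityʳ; ∧-zeroʳ; ∨-zeroʳ; ∧-conicalˡ; ∧-conicalʳ; ∨-conicalˡ; ∨-conicalʳ
        ; ∧-distribʳ-∨; not-injective)
open import Data.Fin using (Fin; zero; suc; _≟_; toℕ; inject₁; fromℕ; inject≤)
open import Data.Fin.Properties using (suc-injective; pigeonhole; toℕ-injective; toℕ<n; toℕ-inject₁; toℕ-fromℕ)
open import Data.Vec using ([]; _∷_; tabulate; lookup)
open import Data.Vec.Properties using (lookup∘tabulate; tabulate∘lookup)
open import Data.Product using (∃; ∃₂; _×_; _,_; proj₁; proj₂)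
open import Data.Sum using (_⊎_; inj₁; inj₂)
open import Data.Empty using (⊥; ⊥-elim)
open import Function using (_∘_; case_of_)
open import Function.Definitions using (Injective)
open import Relation.Nullary using (yes; no; Dec)
open import Relation.Nullary.Decidable using (⌊_⌋; _×-dec_; map′)
open import Relation.Unary using (Decidable)
open import Relation.Binary.PropositionalEquality

-- Finite vertex sets as Boolean predicates

variable
  k n : ℕ

VSet : ℕ → Set
VSet n = Fin n → Bool

true≢false : true ≢ false
true≢false ()

∧-true : ∀ {a b} → a ∧ b ≡ true → a ≡ true × b ≡ true
∧-true {true} b≡true = refl , b≡true

χ : Bool → ℕ
χ true  = 1
χ false = 0

χ-mono : ∀ {a b} → (a ≡ true → b ≡ true) → χ a ≤ χ b
χ-mono {false} _   = z≤n
χ-mono {true}  a⇒b rewrite a⇒b refl = ≤-refl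

χ-∨-∧ : ∀ a b → χ (a ∨ b) + χ (a ∧ b) ≡ χ a + χ b
χ-∨-∧ true  true  = refl
χ-∨-∧ true  false = refl
χ-∨-∧ false b     = +-comm (χ b) 0

∅ : VSet n
∅ _ = false

⁅_⁆ : Fin n → VSet n
⁅ x ⁆ y = ⌊ x ≟ y ⌋

infixl 6 _∪_ _∖_
infixl 7 _∩_
infix 4 _⊆_

_∪_ : VSet n → VSet n → VSet n
(S ∪ M) v = S v ∨ M v

_∩_ : VSet n → VSet n → VSet n
(S ∩ M) v = S v ∧ M v

_∖_ : VSet n → VSet n → VSet n
(S ∖ I) v = not (I v) ∧ S v

∁ : VSet n → VSet n
∁ S v = not (S v)

_⊆_ : VSet n → VSet n → Set
S ⊆ M = ∀ v → S v ≡ true → M v ≡ true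

⁅⁆-refl : ∀ (x : Fin n) → ⁅ x ⁆ x ≡ true
⁅⁆-refl x with x ≟ x
... | yes _  = refl
... | no x≢x = ⊥-elim (x≢x refl)

⁅⁆-sound : ∀ {x y : Fin n} → ⁅ x ⁆ y ≡ true → x ≡ y
⁅⁆-sound {x = x} {y} e with x ≟ y
... | yes x≡y = x≡y

⁅⁆-≢ : ∀ {x y : Fin n} → x ≢ y → ⁅ x ⁆ y ≡ false
⁅⁆-≢ {x = x} {y} x≢y with x ≟ y
... | yes x≡y = ⊥-elim (x≢y x≡y)
... | no _    = refl

⁅suc⁆ : ∀ (x y : Fin n) → ⁅ suc x ⁆ (suc y) ≡ ⁅ x ⁆ y
⁅suc⁆ x y with x ≟ y
... | yes _ = refl
... | no _  = refl

S⊆S∪M : ∀ {S M : VSet n} → S ⊆ S ∪ M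
S⊆S∪M v Sv rewrite Sv = refl

M⊆S∪M : ∀ {S M : VSet n} → M ⊆ S ∪ M
M⊆S∪M {S = S} v Mv rewrite Mv = ∨-zeroʳ (S v)

S∪M⊆I∪S∪M : ∀ {I S M : VSet n} → S ∪ M ⊆ I ∪ S ∪ M
S∪M⊆I∪S∪M {I = I} v e with I v
... | true  = refl
... | false = e

∪-lub : ∀ {S M U : VSet n} → S ⊆ U → M ⊆ U → S ∪ M ⊆ U
∪-lub {S = S} S⊆U M⊆U v e with S v in Sv
... | true  = S⊆U v Sv
... | false = M⊆U v e

⁅x⁆⊆S : ∀ {S : VSet n} {x} → S x ≡ true → ⁅ x ⁆ ⊆ S
⁅x⁆⊆S {S = S} Sx v e = subst (λ z → S z ≡ true) (⁅⁆-sound e) Sx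

anyFin-intro : ∀ (p : Fin k → Bool) i → p i ≡ true → anyFin p ≡ true
anyFin-intro p zero    pi rewrite pi = refl
anyFin-intro p (suc i) pi with p zero
... | true  = refl
... | false = anyFin-intro (p ∘ suc) i pi

anyFin-elim : ∀ (p : Fin k → Bool) → anyFin p ≡ true → ∃ λ i → p i ≡ true
anyFin-elim {suc k} p any with p zero in eq
... | true  = zero , eq
... | false = let i , pi = anyFin-elim (p ∘ suc) any in suc i , pi

anyFin-mono : ∀ {p q : Fin k → Bool} → (∀ i → p i ≡ true → q i ≡ true) → anyFin p ≡ true → anyFin q ≡ true
anyFin-mono {p = p} {q} p⇒q any = let i , pi = anyFin-elim p any in anyFin-intro q i (p⇒q i pi)

anyFin≡false⇒ : ∀ (p : Fin k → Bool) → anyFin p ≡ false → ∀ i → p i ≡ false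
anyFin≡false⇒ p none i with p i in eq
... | false = refl
... | true  = trans (sym (anyFin-intro p i eq)) none

anyFin≡false : ∀ (p : Fin k → Bool) → (∀ i → p i ≡ false) → anyFin p ≡ false
anyFin≡false p none with anyFin p in eq
... | false = refl
... | true  = let i , pi = anyFin-elim p eq in trans (sym pi) (none i)

anyFin-cong : ∀ {p q : Fin k → Bool} → (∀ i → p i ≡ q i) → anyFin p ≡ anyFin q
anyFin-cong {zero}  p≡q = refl
anyFin-cong {suc k} p≡q = cong₂ _∨_ (p≡q zero) (anyFin-cong (p≡q ∘ suc))

anyFin-∨ : ∀ (p q : Fin k → Bool) → anyFin (λ i → p i ∨ q i) ≡ anyFin p ∨ anyFin q
anyFin-∨ {zero}  p q = refl
anyFin-∨ {suc k} p q with p zero | q zero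
... | true  | _     = refl
... | false | true  = sym (∨-zeroʳ _)
... | false | false = anyFin-∨ (p ∘ suc) (q ∘ suc)

sum-mono-≤ : ∀ {f g : Fin n → ℕ} → (∀ i → f i ≤ g i) → sum f ≤ sum g
sum-mono-≤ {zero}  f≤g = z≤n
sum-mono-≤ {suc n} f≤g = +-mono-≤ (f≤g zero) (sum-mono-≤ (f≤g ∘ suc))

sum-≥-term : ∀ (f : Fin n → ℕ) i → f i ≤ sum f
sum-≥-term f zero    = m≤m+n _ _
sum-≥-term f (suc i) = ≤-trans (sum-≥-term (f ∘ suc) i) (m≤n+m _ _)

sum-≤-+ : ∀ {f g h : Fin n → ℕ} → (∀ i → f i ≤ g i + h i) → sum f ≤ sum g + sum h
sum-≤-+ {g = g} {h} p = ≤-trans (sum-mono-≤ p) (≤-reflexive (∑-distrib-+ g h))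

sum-+-≤ : ∀ {f g h : Fin n → ℕ} → (∀ i → f i + g i ≤ h i) → sum f + sum g ≤ sum h
sum-+-≤ {f = f} {g} p = ≤-trans (≤-reflexive (sym (∑-distrib-+ f g))) (sum-mono-≤ p)

sum-+-≤-+ : ∀ {f g h k : Fin n → ℕ} → (∀ i → f i + g i ≤ h i + k i) →
  sum f + sum g ≤ sum h + sum k
sum-+-≤-+ {h = h} {k} p = ≤-trans (sum-+-≤ p) (≤-reflexive (∑-distrib-+ h k))

size : VSet n → ℕ
size S = sum (χ ∘ S)

size-cong : ∀ {S M : VSet n} → (∀ v → S v ≡ M v) → size S ≡ size M
size-cong S≗M = sum-cong-≗ (cong χ ∘ S≗M)

size-mono : ∀ {S M : VSet n} → S ⊆ M → size S ≤ size M
size-mono S⊆M = sum-mono-≤ (λ v → χ-mono (S⊆M v))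

size-∪-∩ : ∀ (S M : VSet n) → size (S ∪ M) + size (S ∩ M) ≡ size S + size M
size-∪-∩ S M = begin
  size (S ∪ M) + size (S ∩ M)                ≡⟨ ∑-distrib-+ (χ ∘ (S ∪ M)) (χ ∘ (S ∩ M)) ⟨
  sum (λ v → χ (S v ∨ M v) + χ (S v ∧ M v))  ≡⟨ sum-cong-≗ (λ v → χ-∨-∧ (S v) (M v)) ⟩
  sum (λ v → χ (S v) + χ (M v))              ≡⟨ ∑-distrib-+ (χ ∘ S) (χ ∘ M) ⟩
  size S + size M                            ∎
  where open ≡-Reasoning

size-∪ : ∀ (S M : VSet n) → size (S ∪ M) ≤ size S + size M
size-∪ S M = ≤-trans (m≤m+n _ _) (≤-reflexive (size-∪-∩ S M))

size-empty : ∀ (S : VSet n) → (∀ v → S v ≡ false) → size S ≡ 0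
size-empty {zero}  S none = refl
size-empty {suc n} S none rewrite none zero = size-empty (S ∘ suc) (none ∘ suc)

size-∅ : size (∅ {n}) ≡ 0
size-∅ {n} = size-empty {n} ∅ λ _ → refl

size-full : ∀ (S : VSet n) → (∀ v → S v ≡ true) → size S ≡ n
size-full {zero}  S all = refl
size-full {suc n} S all rewrite all zero = cong suc (size-full (S ∘ suc) (all ∘ suc))

size-≤ : ∀ (S : VSet n) → size S ≤ n
size-≤ {n} S = ≤-trans (size-mono {M = full} (λ _ _ → refl)) (≤-reflexive (size-full full λ _ → refl))
  where
  full : VSet n
  full _ = true

size-∁ : ∀ (S : VSet n) → size S + size (∁ S) ≡ n
size-∁ {n} S = trans (sym (∑-distrib-+ (χ ∘ S) (χ ∘ ∁ S)))
  (trans (sum-cong-≗ (λ v → pointwise (S v))) (size-full {n} (λ _ → true) (λ _ → refl)))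
  where
  pointwise : ∀ b → χ b + χ (not b) ≡ 1
  pointwise true  = refl
  pointwise false = refl

size-⁅⁆ : ∀ (x : Fin n) → size ⁅ x ⁆ ≡ 1
size-⁅⁆ {suc n} zero    = cong suc (size-empty {n} (⁅ zero ⁆ ∘ suc) λ _ → refl)
size-⁅⁆ {suc n} (suc x) = trans (sum-cong-≗ (cong χ ∘ ⁅suc⁆ x)) (size-⁅⁆ x)

size-∧⁅⁆ : ∀ b (x : Fin n) → size (λ v → b ∧ ⁅ x ⁆ v) ≡ χ b
size-∧⁅⁆ true  x = size-⁅⁆ x
size-∧⁅⁆ {n} false x = size-empty {n} (λ _ → false) (λ _ → refl)

size-∩⁅⁆ : ∀ (S : VSet n) x → size (S ∩ ⁅ x ⁆) ≡ χ (S x)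
size-∩⁅⁆ S x = trans (size-cong pointwise) (size-∧⁅⁆ (S x) x)
  where
  pointwise : ∀ v → S v ∧ ⁅ x ⁆ v ≡ S x ∧ ⁅ x ⁆ v
  pointwise v with x ≟ v
  ... | yes refl = refl
  ... | no _     = trans (∧-zeroʳ (S v)) (sym (∧-zeroʳ (S x)))

∈⇒size≥1 : ∀ (S : VSet n) {x} → S x ≡ true → 1 ≤ size S
∈⇒size≥1 S {x} Sx = ≤-trans (≤-reflexive (cong χ (sym Sx))) (sum-≥-term (χ ∘ S) x)

size≥1⇒∈ : ∀ (S : VSet n) → 1 ≤ size S → ∃ λ x → S x ≡ true
size≥1⇒∈ {suc n} S 1≤ with S zero in eq
... | true  = zero , eq
... | false = let x , Sx = size≥1⇒∈ (S ∘ suc) 1≤ in suc x , Sx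

size≡0⇒∉ : ∀ (S : VSet n) → size S ≡ 0 → ∀ v → S v ≡ false
size≡0⇒∉ S s≡0 v with S v in eq
... | false = refl
... | true  = ⊥-elim (1+n≰n (≤-trans (∈⇒size≥1 S eq) (≤-reflexive s≡0)))

size<n⇒∉ : ∀ (S : VSet n) → size S < n → ∃ λ v → S v ≡ false
size<n⇒∉ S S<n = let v , ∁Sv = size≥1⇒∈ (∁ S) 1≤∁S in v , not-injective ∁Sv
  where
  1≤∁S : 1 ≤ size (∁ S)
  1≤∁S = +-cancelˡ-≤ (size S) 1 _ (≤-trans (≤-reflexive (+-comm (size S) 1))
           (≤-trans S<n (≤-reflexive (sym (size-∁ S)))))

size-∖⁅⁆ : ∀ (S : VSet n) {x} → S x ≡ true → size S ≡ suc (size (S ∖ ⁅ x ⁆))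
size-∖⁅⁆ S {x} Sx = begin
  size S                                      ≡⟨ sum-cong-≗ split ⟩
  sum (λ v → χ ((S ∖ ⁅ x ⁆) v) + χ (⁅ x ⁆ v))  ≡⟨ ∑-distrib-+ (χ ∘ (S ∖ ⁅ x ⁆)) (χ ∘ ⁅ x ⁆) ⟩
  size (S ∖ ⁅ x ⁆) + size ⁅ x ⁆                ≡⟨ cong (size (S ∖ ⁅ x ⁆) +_) (size-⁅⁆ x) ⟩
  size (S ∖ ⁅ x ⁆) + 1                         ≡⟨ +-comm _ 1 ⟩
  suc (size (S ∖ ⁅ x ⁆))                       ∎
  where
  open ≡-Reasoning
  split : ∀ v → χ (S v) ≡ χ ((S ∖ ⁅ x ⁆) v) + χ (⁅ x ⁆ v)
  split v with x ≟ v
  ... | yes refl rewrite Sx = refl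
  ... | no _     = sym (+-identityʳ _)

size-∪-disjoint : ∀ (S M : VSet n) → (∀ v → S v ≡ true → M v ≡ false) →
  size (S ∪ M) ≡ size S + size M
size-∪-disjoint S M disj = begin
  size (S ∪ M)                ≡⟨ +-identityʳ _ ⟨
  size (S ∪ M) + 0            ≡⟨ cong (size (S ∪ M) +_) (size-empty (S ∩ M) S∩M≡∅) ⟨
  size (S ∪ M) + size (S ∩ M) ≡⟨ size-∪-∩ S M ⟩
  size S + size M             ∎
  where
  open ≡-Reasoning
  S∩M≡∅ : ∀ v → S v ∧ M v ≡ false
  S∩M≡∅ v with S v in eq
  ... | true  = disj v eq
  ... | false = refl

size-∪⁅⁆ : ∀ (S : VSet n) {x} → S x ≡ false → size (S ∪ ⁅ x ⁆) ≡ suc (size S)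
size-∪⁅⁆ S {x} Sx = trans (size-∪-disjoint S ⁅ x ⁆ x∉S) (trans (cong (size S +_) (size-⁅⁆ x)) (+-comm _ 1))
  where
  x∉S : ∀ v → S v ≡ true → ⁅ x ⁆ v ≡ false
  x∉S v Sv = ⁅⁆-≢ λ { refl → true≢false (trans (sym Sv) Sx) }

size-∪-∖ : ∀ (S M : VSet n) → size (S ∪ M) ≤ size S + size (M ∖ S)
size-∪-∖ S M = sum-≤-+ (λ v → pointwise (S v) (M v))
  where
  pointwise : ∀ s a → χ (s ∨ a) ≤ χ s + χ (not s ∧ a)
  pointwise true  a = ≤-refl
  pointwise false a = ≤-refl

size-∖-∪ : ∀ (S I J : VSet n) → size (S ∖ I) ≤ size (S ∖ (I ∪ J)) + size (S ∩ J)
size-∖-∪ S I J = sum-≤-+ (λ v → pointwise (S v) (I v) (J v))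
  where
  pointwise : ∀ s i j → χ (not i ∧ s) ≤ χ (not (i ∨ j) ∧ s) + χ (s ∧ j)
  pointwise s     true  j     = z≤n
  pointwise false false j     = z≤n
  pointwise true  false false = ≤-refl
  pointwise true  false true  = ≤-refl

size-∖-antitone : ∀ (S : VSet n) {I J} → J ⊆ I → size (S ∖ I) ≤ size (S ∖ J)
size-∖-antitone S {I} {J} J⊆I = size-mono λ v → pointwise (J⊆I v)
  where
  pointwise : ∀ {s i j} → (j ≡ true → i ≡ true) → not i ∧ s ≡ true → not j ∧ s ≡ true
  pointwise {j = false} _   e = ∧-conicalʳ _ _ e
  pointwise {i = false} {j = true} j⇒i e with () ← j⇒i refl

size-∖-strictly-antitone : ∀ (S : VSet n) {I J x} → J ⊆ I → S x ≡ true → I x ≡ true → J x ≡ false →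
  suc (size (S ∖ I)) ≤ size (S ∖ J)
size-∖-strictly-antitone S {I} {J} {x} J⊆I Sx Ix Jx = begin
  suc (size (S ∖ I))        ≡⟨ size-∪⁅⁆ (S ∖ I) x∉S∖I ⟨
  size ((S ∖ I) ∪ ⁅ x ⁆)    ≤⟨ size-mono ⊆S∖J ⟩
  size (S ∖ J)              ∎
  where
  open ≤-Reasoning
  x∉S∖I : not (I x) ∧ S x ≡ false
  x∉S∖I rewrite Ix = refl
  ⊆S∖J : (S ∖ I) ∪ ⁅ x ⁆ ⊆ S ∖ J
  ⊆S∖J v e with x ≟ v
  ... | yes refl rewrite Jx = Sx
  ... | no _ with I v in Iv | J v in Jv
  ...   | false | false = trans (sym (∨-identityʳ _)) e
  ...   | false | true  with () ← trans (sym Iv) (J⊆I v Jv)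
  ...   | true  | _     with () ← e

complement-trade : ∀ {a b} (X Y : VSet n) → a + size (∁ X) ≤ b + size (∁ Y) → a + size Y ≤ b + size X
complement-trade {n} {a} {b} X Y le = +-cancelʳ-≤ n _ _ (begin
  a + size Y + n                              ≡⟨ cong (a + size Y +_) (size-∁ X) ⟨
  a + size Y + (size X + size (∁ X))          ≡⟨ regroupˡ a (size Y) (size X) (size (∁ X)) ⟩
  a + size (∁ X) + (size X + size Y)          ≤⟨ +-monoˡ-≤ _ le ⟩
  b + size (∁ Y) + (size X + size Y)          ≡⟨ regroupʳ b (size (∁ Y)) (size X) (size Y) ⟩
  b + size X + (size Y + size (∁ Y))          ≡⟨ cong (b + size X +_) (size-∁ Y) ⟩
  b + size X + n                              ∎)
  where
  open ≤-Reasoning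
  regroupˡ : ∀ a y x x' → a + y + (x + x') ≡ a + x' + (x + y)
  regroupˡ = solve-∀
  regroupʳ : ∀ b y' x y → b + y' + (x + y) ≡ b + x + (y + y')
  regroupʳ = solve-∀

weight : (Fin n → ℕ) → VSet n → ℕ
weight w S = sum λ v → χ (S v) * w v

weight-cong : ∀ (w : Fin n → ℕ) {S M : VSet n} → (∀ v → S v ≡ M v) → weight w S ≡ weight w M
weight-cong w S≗M = sum-cong-≗ λ v → cong (λ b → χ b * w v) (S≗M v)

weight-mono : ∀ {w w' : Fin n → ℕ} S → (∀ v → w v ≤ w' v) → weight w S ≤ weight w' S
weight-mono S w≤w' = sum-mono-≤ λ v → *-monoʳ-≤ (χ (S v)) (w≤w' v)

weight-∪-∩ : ∀ (w : Fin n → ℕ) S M →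
  weight w (S ∪ M) + weight w (S ∩ M) ≡ weight w S + weight w M
weight-∪-∩ w S M = begin
  weight w (S ∪ M) + weight w (S ∩ M)
    ≡⟨ ∑-distrib-+ (λ v → χ (S v ∨ M v) * w v) (λ v → χ (S v ∧ M v) * w v) ⟨
  sum (λ v → χ (S v ∨ M v) * w v + χ (S v ∧ M v) * w v)
    ≡⟨ sum-cong-≗ pointwise ⟩
  sum (λ v → χ (S v) * w v + χ (M v) * w v)
    ≡⟨ ∑-distrib-+ (λ v → χ (S v) * w v) (λ v → χ (M v) * w v) ⟩
  weight w S + weight w M ∎
  where
  open ≡-Reasoning
  pointwise : ∀ v → χ (S v ∨ M v) * w v + χ (S v ∧ M v) * w v ≡ χ (S v) * w v + χ (M v) * w v
  pointwise v = begin
    χ (S v ∨ M v) * w v + χ (S v ∧ M v) * w v ≡⟨ *-distribʳ-+ (w v) (χ (S v ∨ M v)) _ ⟨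
    (χ (S v ∨ M v) + χ (S v ∧ M v)) * w v     ≡⟨ cong (_* w v) (χ-∨-∧ (S v) (M v)) ⟩
    (χ (S v) + χ (M v)) * w v                 ≡⟨ *-distribʳ-+ (w v) (χ (S v)) _ ⟩
    χ (S v) * w v + χ (M v) * w v             ∎

weight-∪ : ∀ (w : Fin n → ℕ) S M → weight w (S ∪ M) ≤ weight w S + weight w M
weight-∪ w S M = ≤-trans (m≤m+n _ _) (≤-reflexive (weight-∪-∩ w S M))

weight-∅ : ∀ (w : Fin n → ℕ) → weight w ∅ ≡ 0
weight-∅ {zero}  w = refl
weight-∅ {suc n} w = weight-∅ (w ∘ suc)

weight-⁅⁆ : ∀ (w : Fin n → ℕ) x → weight w ⁅ x ⁆ ≡ w x
weight-⁅⁆ {suc n} w zero    = trans (cong (w zero + 0 +_) (weight-∅ {n} (w ∘ suc))) (trans (+-identityʳ _) (+-identityʳ _))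
weight-⁅⁆ {suc n} w (suc x) =
  trans (sum-cong-≗ λ y → cong (λ b → χ b * w (suc y)) (⁅suc⁆ x y)) (weight-⁅⁆ (w ∘ suc) x)

weight-+χ : ∀ (w : Fin n → ℕ) Z S → weight (λ v → w v + χ (Z v)) S ≡ weight w S + size (S ∩ Z)
weight-+χ w Z S = trans (sum-cong-≗ pointwise) (∑-distrib-+ (λ v → χ (S v) * w v) (χ ∘ (S ∩ Z)))
  where
  pointwise : ∀ v → χ (S v) * (w v + χ (Z v)) ≡ χ (S v) * w v + χ (S v ∧ Z v)
  pointwise v with S v
  ... | true  = trans (*-identityˡ _) (cong (_+ χ (Z v)) (sym (*-identityˡ (w v))))
  ... | false = refl

weight-χ* : ∀ (c : ℕ) (B S : VSet n) → weight (λ v → χ (B v) * c) S ≡ c * size (S ∩ B)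
weight-χ* c B S = trans (sum-cong-≗ pointwise) (sym (*-distribˡ-sum c (χ ∘ (S ∩ B))))
  where
  pointwise : ∀ v → χ (S v) * (χ (B v) * c) ≡ c * χ (S v ∧ B v)
  pointwise v with S v | B v
  ... | true  | true  = trans (*-identityˡ _) (trans (*-identityˡ c) (sym (*-identityʳ c)))
  ... | true  | false = sym (*-zeroʳ c)
  ... | false | _     = sym (*-zeroʳ c)

weight-≤ : ∀ (w : Fin n → ℕ) S {d} → (∀ v → S v ≡ true → w v ≤ d) → weight w S ≤ size S * d
weight-≤ w S {d} w≤d = ≤-trans (sum-mono-≤ pointwise) (≤-reflexive (sym (*-distribʳ-sum d (χ ∘ S))))
  where
  pointwise : ∀ v → χ (S v) * w v ≤ χ (S v) * d
  pointwise v with S v in eq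
  ... | true  = *-monoʳ-≤ 1 (w≤d v eq)
  ... | false = z≤n

image : (Fin k → Fin n) → VSet k → VSet n
image φ S v = anyFin λ u → S u ∧ ⁅ φ u ⁆ v

size-image : ∀ (φ : Fin k → Fin n) → Injective _≡_ _≡_ φ → ∀ S → size (image φ S) ≡ size S
size-image {zero}  φ φ-inj S = size-empty (image φ S) (λ _ → refl)
size-image {suc k} φ φ-inj S = begin
  size (φ₀ ∪ image (φ ∘ suc) (S ∘ suc))    ≡⟨ size-∪-disjoint φ₀ _ disjoint ⟩
  size φ₀ + size (image (φ ∘ suc) (S ∘ suc))
    ≡⟨ cong₂ _+_ size-φ₀ (size-image (φ ∘ suc) (suc-injective ∘ φ-inj) (S ∘ suc)) ⟩
  size S                                     ∎
  where
  open ≡-Reasoning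
  φ₀ : VSet _
  φ₀ v = S zero ∧ ⁅ φ zero ⁆ v
  size-φ₀ : size φ₀ ≡ χ (S zero)
  size-φ₀ = size-∧⁅⁆ (S zero) (φ zero)
  disjoint : ∀ v → φ₀ v ≡ true → image (φ ∘ suc) (S ∘ suc) v ≡ false
  disjoint v φ₀v = anyFin≡false _ λ u → ⁅φ₀⁆ u (⁅⁆-sound (∧-conicalʳ (S zero) _ φ₀v))
    where
    ⁅φ₀⁆ : ∀ u → φ zero ≡ v → S (suc u) ∧ ⁅ φ (suc u) ⁆ v ≡ false
    ⁅φ₀⁆ u refl with φ (suc u) ≟ φ zero
    ... | yes e = case φ-inj e of λ ()
    ... | no _  = ∧-zeroʳ _

enumerate : ∀ (S : VSet n) → k ≤ size S →
  Σ (Fin k → Fin n) λ f → Injective _≡_ _≡_ f × (∀ i → S (f i) ≡ true)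
enumerate {n} {zero} S _ = (λ ()) , (λ {i} → case i of λ ()) , (λ ())
enumerate {suc n} {suc k} S k<S with S zero in eq
... | true  = let f , f-inj , f∈S = enumerate (S ∘ suc) (≤-pred k<S) in
  (λ { zero → zero ; (suc i) → suc (f i) }) ,
  (λ { {zero} {zero} _ → refl ; {suc i} {suc j} e → cong suc (f-inj (suc-injective e)) }) ,
  (λ { zero → eq ; (suc i) → f∈S i })
... | false = let f , f-inj , f∈S = enumerate (S ∘ suc) k<S in
  (suc ∘ f) , (f-inj ∘ suc-injective) , f∈S

size-tabulate : ∀ {n} (S : VSet n) → ∣ tabulate S ∣ ≡ size S
size-tabulate {zero}  S = refl
size-tabulate {suc n} S with S zero | size-tabulate (S ∘ suc)
... | true  | ih = cong suc ih
... | false | ih = ih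

size-lookup : ∀ {n} (S : Subset n) → ∣ S ∣ ≡ size (lookup S)
size-lookup S = trans (cong ∣_∣ (sym (tabulate∘lookup S))) (size-tabulate (lookup S))

Maximiser : ∀ {n} → (Subset n → Set) → (Subset n → ℕ) → Subset n → Set
Maximiser P g s = P s × (∀ s' → P s' → g s' ≤ g s)

maximiser? : ∀ {n} (P : Subset n → Set) → Decidable P → (g : Subset n → ℕ) →
  (∀ s → ¬ P s) ⊎ ∃ (Maximiser P g)
maximiser? {zero} P P? g with P? []
... | yes p = inj₂ ([] , p , λ { [] _ → ≤-refl })
... | no ¬p = inj₁ λ { [] → ¬p }
maximiser? {suc n} P P? g with maximiser? (P ∘ (true ∷_)) (P? ∘ (true ∷_)) (g ∘ (true ∷_))
                              | maximiser? (P ∘ (false ∷_)) (P? ∘ (false ∷_)) (g ∘ (false ∷_))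
... | inj₁ ¬T | inj₁ ¬F = inj₁ λ { (true ∷ s) → ¬T s ; (false ∷ s) → ¬F s }
... | inj₂ (s , p , max) | inj₁ ¬F =
  inj₂ (true ∷ s , p , λ { (true ∷ s') p' → max s' p' ; (false ∷ s') p' → ⊥-elim (¬F s' p') })
... | inj₁ ¬T | inj₂ (s , p , max) =
  inj₂ (false ∷ s , p , λ { (true ∷ s') p' → ⊥-elim (¬T s' p') ; (false ∷ s') p' → max s' p' })
... | inj₂ (sT , pT , maxT) | inj₂ (sF , pF , maxF) with ≤-total (g (true ∷ sT)) (g (false ∷ sF))
...   | inj₁ T≤F = inj₂ (false ∷ sF , pF ,
          λ { (true ∷ s') p' → ≤-trans (maxT s' p') T≤F ; (false ∷ s') p' → maxF s' p' })
...   | inj₂ F≤T = inj₂ (true ∷ sT , pT ,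
          λ { (true ∷ s') p' → maxT s' p' ; (false ∷ s') p' → ≤-trans (maxF s' p') F≤T })

maximiser : ∀ {n} (P : Subset n → Set) → Decidable P → (g : Subset n → ℕ) →
  ∀ {s₀} → P s₀ → ∃ (Maximiser P g)
maximiser P P? g {s₀} p₀ with maximiser? P P? g
... | inj₁ ¬P = ⊥-elim (¬P s₀ p₀)
... | inj₂ max = max

-- Neighbourhoods

module Neighbourhood {n : ℕ} (G : Graph n) where

  adjTo : VSet n → VSet n
  adjTo S v = anyFin λ u → S u ∧ adj G u v

  N : VSet n → VSet n
  N S v = not (S v) ∧ adjTo S v

  adjTo-mono : ∀ {S M} → S ⊆ M → adjTo S ⊆ adjTo M
  adjTo-mono S⊆M v = anyFin-mono λ u e →
    cong₂ _∧_ (S⊆M u (∧-conicalˡ _ _ e)) (∧-conicalʳ _ _ e)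

  adjTo-∪ : ∀ S M v → adjTo (S ∪ M) v ≡ adjTo S v ∨ adjTo M v
  adjTo-∪ S M v = trans (anyFin-cong λ u → ∧-distribʳ-∨ (adj G u v) (S u) (M u))
                        (anyFin-∨ (λ u → S u ∧ adj G u v) (λ u → M u ∧ adj G u v))

  adjTo-⁅⁆ : ∀ {x v} → adjTo ⁅ x ⁆ v ≡ true → adj G x v ≡ true
  adjTo-⁅⁆ {x} {v} e with anyFin-elim (λ u → ⁅ x ⁆ u ∧ adj G u v) e
  ... | u , e' = subst (λ z → adj G z v ≡ true) (sym (⁅⁆-sound (∧-conicalˡ _ _ e'))) (∧-conicalʳ _ _ e')

  N-∅ : ∀ v → N ∅ v ≡ false
  N-∅ v = anyFin≡false (λ u → ∅ u ∧ adj G u v) λ _ → refl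

  N-cong : ∀ {S S'} → (∀ v → S v ≡ S' v) → ∀ v → N S v ≡ N S' v
  N-cong S≗S' v = cong₂ (λ a b → not a ∧ b) (S≗S' v) (anyFin-cong λ u → cong (_∧ adj G u v) (S≗S' u))

  N-submodular : ∀ I S M →
    size (N (S ∪ M) ∖ I) + size (N (S ∩ M) ∖ I) ≤ size (N S ∖ I) + size (N M ∖ I)
  N-submodular I S M = sum-+-≤-+ λ v →
    subst (λ a → χ (not (I v) ∧ (not (S v ∨ M v) ∧ a)) + χ ((N (S ∩ M) ∖ I) v)
                   ≤ χ ((N S ∖ I) v) + χ ((N M ∖ I) v))
      (sym (adjTo-∪ S M v)) (pointwise (I v) (S v) (M v) (adjTo S v) (adjTo M v) (∩-both v))
    where
    ∩-both : ∀ v → adjTo (S ∩ M) v ≡ true → adjTo S v ∧ adjTo M v ≡ true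
    ∩-both v e rewrite adjTo-mono (λ u → ∧-conicalˡ (S u) _) v e
                     | adjTo-mono (λ u → ∧-conicalʳ (S u) _) v e = refl
    pointwise : ∀ i s m aS aM {aI} → (aI ≡ true → aS ∧ aM ≡ true) →
      χ (not i ∧ (not (s ∨ m) ∧ (aS ∨ aM))) + χ (not i ∧ (not (s ∧ m) ∧ aI))
        ≤ χ (not i ∧ (not s ∧ aS)) + χ (not i ∧ (not m ∧ aM))
    pointwise true  s     m     aS aM aI⇒ = z≤n
    pointwise false true  true  aS aM aI⇒ = z≤n
    pointwise false true  false aS aM aI⇒ = χ-mono (∧-conicalʳ aS aM ∘ aI⇒)
    pointwise false false true  aS aM aI⇒ =
      ≤-trans (χ-mono (∧-conicalˡ aS aM ∘ aI⇒)) (≤-reflexive (sym (+-identityʳ _)))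
    pointwise false false false aS aM aI⇒ =
      ≤-trans (+-monoʳ-≤ (χ (aS ∨ aM)) (χ-mono aI⇒)) (≤-reflexive (χ-∨-∧ aS aM))

  N-∪-⊆ : ∀ S B → N (S ∪ B) ⊆ N B ∪ (N S ∖ B)
  N-∪-⊆ S B v e = pointwise (S v) (B v) _ _ (subst (λ a → not (S v ∨ B v) ∧ a ≡ true) (adjTo-∪ S B v) e)
    where
    pointwise : ∀ s b aS aB → not (s ∨ b) ∧ (aS ∨ aB) ≡ true → (not b ∧ aB) ∨ (not b ∧ (not s ∧ aS)) ≡ true
    pointwise false false _     true  _ = refl
    pointwise false false true  false _ = refl

  N-∪⁅⁆-⊆ : ∀ I M x → N (M ∪ ⁅ x ⁆) ∖ I ⊆ (N M ∖ I) ∪ (adj G x ∖ (I ∪ M ∪ N M))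
  N-∪⁅⁆-⊆ I M x v e = pointwise (I v) (M v) (⁅ x ⁆ v) (adjTo M v) (adjTo-⁅⁆ {x} {v})
    (subst (λ a → not (I v) ∧ (not (M v ∨ ⁅ x ⁆ v) ∧ a) ≡ true) (adjTo-∪ M ⁅ x ⁆ v) e)
    where
    pointwise : ∀ i m e aM {aX xv} → (aX ≡ true → xv ≡ true) → not i ∧ (not (m ∨ e) ∧ (aM ∨ aX)) ≡ true →
      (not i ∧ (not m ∧ aM)) ∨ (not ((i ∨ m) ∨ (not m ∧ aM)) ∧ xv) ≡ true
    pointwise false false false true  _   _ = refl
    pointwise false false false false aX⇒ e rewrite aX⇒ e = refl

  closure-size : ∀ I S → size (I ∪ S ∪ N S) ≤ size I + size S + size (N S ∖ I)
  closure-size I S = begin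
    size (I ∪ S ∪ N S)                ≤⟨ size-∪-∖ (I ∪ S) (N S) ⟩
    size (I ∪ S) + size (N S ∖ (I ∪ S)) ≤⟨ +-mono-≤ (size-∪ I S) (size-∖-antitone (N S) {I ∪ S} {I} S⊆S∪M) ⟩
    size I + size S + size (N S ∖ I)  ∎
    where open ≤-Reasoning

  AlmostDominating : ℕ → ℕ → Set
  AlmostDominating m m₂ = ∀ X → m ≤ size X → size (∁ (X ∪ N X)) < m₂

  ¬K⇒almostDominating : ∀ {m m₂} → ¬ ComplementContainsK G m m₂ → AlmostDominating m m₂
  ¬K⇒almostDominating {m} {m₂} noK X m≤X with m₂ ≤? size (∁ (X ∪ N X))
  ... | no m₂≰ = ≰⇒> m₂≰
  ... | yes m₂≤ = ⊥-elim (noK (A , B , A-inj , B-inj , A≢B , no-edge))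
    where
    A = proj₁ (enumerate X m≤X)
    A-inj = proj₁ (proj₂ (enumerate X m≤X))
    A∈X = proj₂ (proj₂ (enumerate X m≤X))
    B = proj₁ (enumerate (∁ (X ∪ N X)) m₂≤)
    B-inj = proj₁ (proj₂ (enumerate (∁ (X ∪ N X)) m₂≤))
    B∉X∪NX : ∀ j → X (B j) ∨ N X (B j) ≡ false
    B∉X∪NX j = not-injective (proj₂ (proj₂ (enumerate (∁ (X ∪ N X)) m₂≤)) j)
    A≢B : ∀ i j → A i ≢ B j
    A≢B i j Ai≡Bj = true≢false (trans (sym (A∈X i)) (trans (cong X Ai≡Bj) (∨-conicalˡ _ _ (B∉X∪NX j))))
    no-edge : ∀ i j → adj G (A i) (B j) ≡ false
    no-edge i j with adj G (A i) (B j) in e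
    ... | false = refl
    ... | true = sym (trans (sym (∨-conicalʳ _ _ (B∉X∪NX j))) B∈NX)
      where
      B∈NX : N X (B j) ≡ true
      B∈NX = cong₂ _∧_ (cong not (∨-conicalˡ _ _ (B∉X∪NX j)))
        (anyFin-intro (λ u → X u ∧ adj G u (B j)) (A i) (cong₂ _∧_ (A∈X i) e))

  N-image∖used⊆ : ∀ {k} (φ : Fin k → Fin n) (used : VSet n) → (∀ u → used (φ u) ≡ true) → ∀ S →
    N (image φ S) ∖ used ⊆ λ v → not (anyFin λ u → ⁅ φ u ⁆ v) ∧ anyFin (λ u → S u ∧ adj G (φ u) v)
  N-image∖used⊆ φ used φ-used S v e with ∧-true e
  ... | v-unused , v∈N with ∧-true v∈N
  ...   | _ , adjacent with anyFin-elim (λ u' → image φ S u' ∧ adj G u' v) adjacent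
  ...     | u' , u'∈φS~v with ∧-true u'∈φS~v
  ...       | u'∈φS , u'~v with anyFin-elim (λ u → S u ∧ ⁅ φ u ⁆ u') u'∈φS
  ...         | u , Su∧φu≡u' with ∧-true Su∧φu≡u'
  ...           | Su , φu≡u' = cong₂ _∧_ (cong not no-preimage)
    (anyFin-intro (λ u → S u ∧ adj G (φ u) v) u
      (cong₂ _∧_ Su (subst (λ z → adj G z v ≡ true) (sym (⁅⁆-sound φu≡u')) u'~v)))
    where
    no-preimage : anyFin (λ u → ⁅ φ u ⁆ v) ≡ false
    no-preimage = anyFin≡false _ λ w → ⁅⁆-≢ λ φw≡v →
      true≢false (trans (sym (φ-used w)) (trans (cong used φw≡v) (not-injective v-unused)))

-- The expansion invariant

m+o≡n⇒m≤n : ∀ {a b} c → a + c ≡ b → a ≤ b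
m+o≡n⇒m≤n {a} c refl = m≤m+n a c

closure-arith : ∀ t D m m₂ {i s a} → m ≤ D * m → i ≤ t + m → s ≤ m + m + m → a ≤ (D + D) * s →
  i + s + a + m₂ ≤ t + 13 * D * m + m₂
closure-arith t D m m₂ {i} {s} {a} m≤Dm i≤ s≤ a≤ = begin
  i + s + a + m₂
    ≤⟨ +-monoˡ-≤ m₂ (+-mono-≤ (+-mono-≤ i≤' s≤') a≤') ⟩
  t + D * m + (D * m + D * m + D * m) + (D + D) * (m + m + m) + m₂
    ≤⟨ m+o≡n⇒m≤n (3 * D * m) (regroup t D m m₂) ⟩
  t + 13 * D * m + m₂ ∎
  where
  open ≤-Reasoning
  i≤' = ≤-trans i≤ (+-monoʳ-≤ t m≤Dm)
  s≤' = ≤-trans s≤ (+-mono-≤ (+-mono-≤ m≤Dm m≤Dm) m≤Dm)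
  a≤' = ≤-trans a≤ (*-monoʳ-≤ (D + D) s≤)
  regroup : ∀ t D m m₂ → t + D * m + (D * m + D * m + D * m) + (D + D) * (m + m + m) + m₂ + 3 * D * m
    ≡ t + 13 * D * m + m₂
  regroup = solve-∀

root-arith : ∀ t D m m₂ {i s a} → m ≤ D * m → i + 2 ≤ t + m → suc s ≤ m → a ≤ (D + D) * s →
  i + s + a < t + 13 * D * m + m₂
root-arith t D m m₂ {i} {s} {a} m≤Dm i≤ s< a≤ = begin-strict
  i + s + a
    <⟨ m+o≡n⇒m≤n 2 (regroup₁ i s a) ⟩
  i + 2 + suc s + a
    ≤⟨ +-mono-≤ (+-mono-≤ (≤-trans i≤ (+-monoʳ-≤ t m≤Dm)) (≤-trans s< m≤Dm)) a≤' ⟩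
  t + D * m + D * m + (D + D) * m
    ≤⟨ m+o≡n⇒m≤n (9 * D * m + m₂) (regroup₂ t D m m₂) ⟩
  t + 13 * D * m + m₂ ∎
  where
  open ≤-Reasoning
  a≤' = ≤-trans a≤ (*-monoʳ-≤ (D + D) (≤-trans (n≤1+n s) s<))
  regroup₁ : ∀ i s a → suc (i + s + a) + 2 ≡ i + 2 + suc s + a
  regroup₁ = solve-∀
  regroup₂ : ∀ t D m m₂ → t + D * m + D * m + (D + D) * m + (9 * D * m + m₂) ≡ t + 13 * D * m + m₂
  regroup₂ = solve-∀

module Expansion {n : ℕ} (G : Graph n) (t D m m₂ : ℕ) (1≤D : 1 ≤ D) (1≤m : 1 ≤ m)
  (n-large : t + 13 * D * m + m₂ ≤ n) (dominating : Neighbourhood.AlmostDominating G m m₂) where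
  open Neighbourhood G

  K : ℕ
  K = D + D

  record Expanding (I : VSet n) (w : Fin n → ℕ) : Set where
    field expand : ∀ S → size S ≤ m + m → K * size S ≤ size (N S ∖ I) + weight w S
  open Expanding public

  record Tight (I : VSet n) (w : Fin n → ℕ) (S : VSet n) : Set where
    constructor tight
    field bound : size (N S ∖ I) + weight w S ≤ K * size S
  open Tight public

  m≤Dm : m ≤ D * m
  m≤Dm = ≤-trans (≤-reflexive (sym (*-identityˡ m))) (*-monoˡ-≤ m 1≤D)

  few-new-neighbours⇒small : ∀ {I S} → size I ≤ t + m → size (N S ∖ I) ≤ K * size S →
    size S ≤ m + m + m → size S < m
  few-new-neighbours⇒small {I} {S} I≤ NS≤ S≤ with m ≤? size S
  ... | no m≰S = ≰⇒> m≰S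
  ... | yes m≤S = ⊥-elim (<-irrefl refl (begin-strict
    n                                           ≡⟨ size-∁ (S ∪ N S) ⟨
    size (S ∪ N S) + size (∁ (S ∪ N S))
      <⟨ +-mono-≤-< (size-mono {M = I ∪ S ∪ N S} (S∪M⊆I∪S∪M {I = I})) (dominating S m≤S) ⟩
    size (I ∪ S ∪ N S) + m₂                     ≤⟨ +-monoˡ-≤ m₂ (closure-size I S) ⟩
    size I + size S + size (N S ∖ I) + m₂       ≤⟨ closure-arith t D m m₂ m≤Dm I≤ S≤ NS≤ ⟩
    t + 13 * D * m + m₂                         ≤⟨ n-large ⟩
    n                                           ∎))
    where open ≤-Reasoning

  tight⇒small : ∀ {I w S} → size I ≤ t + m → Tight I w S → size S ≤ m + m + m → size S < m
  tight⇒small I≤ S-tight = few-new-neighbours⇒small I≤ (≤-trans (m≤m+n _ _) (bound S-tight))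

  tight-∪ : ∀ {I w S M} → Expanding I w → size S ≤ m + m → Tight I w S → Tight I w M → Tight I w (S ∪ M)
  tight-∪ {I} {w} {S} {M} I-expanding S≤ S-tight M-tight =
    tight (+-cancelʳ-≤ (K * size (S ∩ M)) _ _ (begin
      (nU + wU) + K * size (S ∩ M)   ≤⟨ +-monoʳ-≤ (nU + wU) (expand I-expanding (S ∩ M) S∩M≤) ⟩
      (nU + wU) + (nI + wI)          ≡⟨ interchange nU wU nI wI ⟩
      (nU + nI) + (wU + wI)          ≤⟨ +-mono-≤ (N-submodular I S M) (≤-reflexive (weight-∪-∩ w S M)) ⟩
      (nS + nM) + (wS + wM)          ≡⟨ interchange nS nM wS wM ⟩
      (nS + wS) + (nM + wM)          ≤⟨ +-mono-≤ (bound S-tight) (bound M-tight) ⟩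
      K * size S + K * size M        ≡⟨ *-distribˡ-+ K (size S) (size M) ⟨
      K * (size S + size M)          ≡⟨ cong (K *_) (size-∪-∩ S M) ⟨
      K * (size (S ∪ M) + size (S ∩ M)) ≡⟨ *-distribˡ-+ K (size (S ∪ M)) (size (S ∩ M)) ⟩
      K * size (S ∪ M) + K * size (S ∩ M) ∎))
    where
    open ≤-Reasoning
    nU = size (N (S ∪ M) ∖ I)
    nI = size (N (S ∩ M) ∖ I)
    nS = size (N S ∖ I)
    nM = size (N M ∖ I)
    wU = weight w (S ∪ M)
    wI = weight w (S ∩ M)
    wS = weight w S
    wM = weight w M
    S∩M≤ = ≤-trans (size-mono {S = S ∩ M} {S} (λ _ → ∧-conicalˡ _ _)) S≤

  Candidate : VSet n → (Fin n → ℕ) → VSet n → VSet n → Set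
  Candidate I w Z S = Tight I w S × size S < m × size (S ∩ Z) ≡ 0

  candidate? : ∀ I w Z S → Dec (Candidate I w Z S)
  candidate? I w Z S = map′ tight bound (_ ≤? _) ×-dec (_ <? m) ×-dec (size (S ∩ Z) ≟ℕ 0)

  candidate-cong : ∀ I w Z {S S'} → (∀ v → S v ≡ S' v) → Candidate I w Z S → Candidate I w Z S'
  candidate-cong I w Z {S} {S'} S≗S' (tight S-bound , small , disjoint) =
    tight (subst₂ _≤_ (cong₂ _+_ (size-cong λ v → cong (not (I v) ∧_) (N-cong S≗S' v)) (weight-cong w S≗S'))
                      (cong (K *_) (size-cong S≗S')) S-bound) ,
    subst (_< m) (size-cong S≗S') small ,
    trans (sym (size-cong λ v → cong (_∧ Z v) (S≗S' v))) disjoint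

  ∅-candidate : ∀ I w Z → Candidate I w Z ∅
  ∅-candidate I w Z =
    tight (≤-trans (≤-reflexive (cong₂ _+_ (size-empty (N ∅ ∖ I) λ v → trans (cong (not (I v) ∧_) (N-∅ v))
                                                                             (∧-zeroʳ _))
                                           (weight-∅ w))) z≤n) ,
    subst (_< m) (sym (size-∅ {n})) 1≤m ,
    size-empty (∅ ∩ Z) λ _ → refl

  record MaximalTight (I : VSet n) (w : Fin n → ℕ) (Z : VSet n) : Set where
    field
      M         : VSet n
      candidate : Candidate I w Z M
      maximal   : ∀ S → Candidate I w Z S → size S ≤ size M

  maximalTight : ∀ I w Z → MaximalTight I w Z
  maximalTight I w Z with maximiser (Candidate I w Z ∘ lookup) (candidate? I w Z ∘ lookup) (size ∘ lookup) {tabulate ∅}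
                                    (candidate-cong I w Z (sym ∘ lookup∘tabulate ∅) (∅-candidate I w Z))
  ... | s , s-candidate , s-max = record
    { M = lookup s ; candidate = s-candidate ; maximal = λ S S-candidate → ≤-trans
        (≤-reflexive (size-cong λ v → sym (lookup∘tabulate S v)))
        (s-max (tabulate S) (candidate-cong I w Z (sym ∘ lookup∘tabulate S) S-candidate)) }

  tight⊆maximal : ∀ {I w Z S} → Expanding I w → size I ≤ t + m → (mt : MaximalTight I w Z) →
    size S ≤ m + m → Tight I w S → size (S ∩ Z) ≡ 0 → S ⊆ MaximalTight.M mt
  tight⊆maximal {I} {w} {Z} {S} I-expanding I≤ mt S≤ S-tight S∩Z≡0 u Su with MaximalTight.M mt u in Mu
  ... | true  = refl
  ... | false = ⊥-elim (1+n≰n (≤-trans bigger (maximal (S ∪ M) (U-tight , U<m , U∩Z≡0))))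
    where
    open MaximalTight mt
    M-tight = proj₁ candidate
    M<m = proj₁ (proj₂ candidate)
    S<m = tight⇒small I≤ S-tight (≤-trans S≤ (m≤m+n _ m))
    U-tight = tight-∪ I-expanding S≤ S-tight M-tight
    U<m = tight⇒small I≤ U-tight
      (≤-trans (size-∪ S M) (≤-trans (+-mono-≤ (<⇒≤ S<m) (<⇒≤ M<m)) (m≤m+n _ m)))
    U∩Z≡0 : size ((S ∪ M) ∩ Z) ≡ 0
    U∩Z≡0 = n≤0⇒n≡0 (begin
      size ((S ∪ M) ∩ Z)           ≡⟨ size-cong (λ v → ∧-distribʳ-∨ (Z v) (S v) (M v)) ⟩
      size (S ∩ Z ∪ M ∩ Z)         ≤⟨ size-∪ (S ∩ Z) (M ∩ Z) ⟩
      size (S ∩ Z) + size (M ∩ Z)  ≡⟨ cong₂ _+_ S∩Z≡0 (proj₂ (proj₂ candidate)) ⟩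
      0                            ∎)
      where open ≤-Reasoning
    bigger : suc (size M) ≤ size (S ∪ M)
    bigger = ≤-trans (≤-reflexive (sym (size-∪⁅⁆ M Mu)))
      (size-mono {M = S ∪ M} (∪-lub (M⊆S∪M {S = S}) (⁅x⁆⊆S {S = S ∪ M} (S⊆S∪M {S = S} {M} u Su))))

  extend-expanding : ∀ {I w Z y} → Expanding I w → size I ≤ t + m → (mt : MaximalTight I w Z) →
    (I ∪ MaximalTight.M mt ∪ N (MaximalTight.M mt)) y ≡ false →
    Expanding (I ∪ ⁅ y ⁆) (λ v → w v + χ (Z v))
  extend-expanding {I} {w} {Z} {y} I-expanding I≤ mt y-free = record { expand = λ S S≤ →
    +-cancelʳ-≤ (χ (N S y)) _ _ (begin
      K * size S + χ (N S y)
        ≤⟨ slack S S≤ ⟩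
      size (N S ∖ I) + weight w S + size (S ∩ Z)
        ≤⟨ +-monoˡ-≤ _ (+-monoˡ-≤ _ (size-∖-∪ (N S) I ⁅ y ⁆)) ⟩
      size (N S ∖ (I ∪ ⁅ y ⁆)) + size (N S ∩ ⁅ y ⁆) + weight w S + size (S ∩ Z)
        ≡⟨ cong (λ c → size (N S ∖ (I ∪ ⁅ y ⁆)) + c + weight w S + size (S ∩ Z)) (size-∩⁅⁆ (N S) y) ⟩
      size (N S ∖ (I ∪ ⁅ y ⁆)) + χ (N S y) + weight w S + size (S ∩ Z)
        ≡⟨ regroup (size (N S ∖ (I ∪ ⁅ y ⁆))) (χ (N S y)) (weight w S) (size (S ∩ Z)) ⟩
      size (N S ∖ (I ∪ ⁅ y ⁆)) + (weight w S + size (S ∩ Z)) + χ (N S y)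
        ≡⟨ cong (λ x → size (N S ∖ (I ∪ ⁅ y ⁆)) + x + χ (N S y)) (weight-+χ w Z S) ⟨
      size (N S ∖ (I ∪ ⁅ y ⁆)) + weight (λ v → w v + χ (Z v)) S + χ (N S y) ∎) }
    where
    open ≤-Reasoning
    open MaximalTight mt
    regroup : ∀ a c x z → a + c + x + z ≡ a + (x + z) + c
    regroup = solve-∀
    M∌y : M y ≡ false
    M∌y = ∨-conicalʳ (I y) _ (∨-conicalˡ _ _ y-free)
    -- Adding y to I costs S at most the neighbour y. That is paid for by the new weight on Z, or by slack;
    -- otherwise S is tight, hence S ⊆ M, and y ∈ N S would put y in N M.
    slack : ∀ S → size S ≤ m + m → K * size S + χ (N S y) ≤ size (N S ∖ I) + weight w S + size (S ∩ Z)
    slack S S≤ with N S y in y∈NS | size (S ∩ Z) in S∩Z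
    ... | false | _     = +-mono-≤ (expand I-expanding S S≤) z≤n
    ... | true  | suc _ = +-mono-≤ (expand I-expanding S S≤) (s≤s z≤n)
    ... | true  | zero with K * size S <? size (N S ∖ I) + weight w S
    ...   | yes loose = ≤-trans (≤-reflexive (+-comm _ 1)) (≤-trans loose (m≤m+n _ 0))
    ...   | no ¬loose = ⊥-elim (true≢false (trans (sym y∈NM) (∨-conicalʳ _ _ y-free)))
      where
      S⊆M = tight⊆maximal I-expanding I≤ mt S≤ (tight (≮⇒≥ ¬loose)) S∩Z
      y∈NM : N M y ≡ true
      y∈NM = cong₂ _∧_ (cong not M∌y) (adjTo-mono S⊆M y (∧-conicalʳ _ _ y∈NS))

  expanding-mono : ∀ {I w w'} → (∀ v → w v ≤ w' v) → Expanding I w → Expanding I w'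
  expanding-mono {w' = w'} w≤w' I-expanding = record { expand = λ S S≤ →
    ≤-trans (expand I-expanding S S≤) (+-monoʳ-≤ _ (weight-mono S w≤w')) }

  root-step : ∀ {I w} → Expanding I w → size I + 2 ≤ t + m → ∃ λ y → I y ≡ false × Expanding (I ∪ ⁅ y ⁆) w
  root-step {I} {w} I-expanding I≤ =
    y , ∨-conicalˡ _ _ (∨-conicalˡ _ _ y-free) ,
    expanding-mono (λ v → ≤-reflexive (+-identityʳ (w v)))
      (extend-expanding I-expanding (≤-trans (m≤m+n _ 2) I≤) mt y-free)
    where
    mt = maximalTight I w ∅
    open MaximalTight mt
    crowded : size (I ∪ M ∪ N M) < n
    crowded = ≤-trans (s≤s (closure-size I M)) (≤-trans
      (root-arith t D m m₂ m≤Dm I≤ (proj₁ (proj₂ candidate)) (≤-trans (m≤m+n _ _) (bound (proj₁ candidate))))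
      n-large)
    y = proj₁ (size<n⇒∉ _ crowded)
    y-free = proj₂ (size<n⇒∉ _ crowded)

  leaf-step : ∀ {I w x} → Expanding I w → size I ≤ t + m → w x < K →
    ∃ λ y → I y ≡ false × adj G x y ≡ true × Expanding (I ∪ ⁅ y ⁆) (λ v → w v + χ (⁅ x ⁆ v))
  leaf-step {I} {w} {x} I-expanding I≤ wx<K =
    y , ∨-conicalˡ _ _ (∨-conicalˡ _ _ y-free) , ∧-conicalʳ _ _ y∈Y , extend-expanding I-expanding I≤ mt y-free
    where
    mt = maximalTight I w ⁅ x ⁆
    open MaximalTight mt
    open ≤-Reasoning
    M∌x : M x ≡ false
    M∌x = trans (sym (∧-identityʳ (M x)))
      (subst (λ b → M x ∧ b ≡ false) (⁅⁆-refl x) (size≡0⇒∉ (M ∩ ⁅ x ⁆) (proj₂ (proj₂ candidate)) x))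
    Y : VSet n
    Y = adj G x ∖ (I ∪ M ∪ N M)
    M+x≤ : size (M ∪ ⁅ x ⁆) ≤ m + m
    M+x≤ = ≤-trans (≤-reflexive (size-∪⁅⁆ M M∌x)) (≤-trans (proj₁ (proj₂ candidate)) (m≤m+n m m))
    K≤ : K ≤ size Y + w x
    K≤ = +-cancelˡ-≤ (K * size M) _ _ (begin
      K * size M + K                                   ≡⟨ +-comm (K * size M) K ⟩
      K + K * size M                                   ≡⟨ *-suc K (size M) ⟨
      K * suc (size M)                                 ≡⟨ cong (K *_) (size-∪⁅⁆ M M∌x) ⟨
      K * size (M ∪ ⁅ x ⁆)                             ≤⟨ expand I-expanding (M ∪ ⁅ x ⁆) M+x≤ ⟩
      size (N (M ∪ ⁅ x ⁆) ∖ I) + weight w (M ∪ ⁅ x ⁆)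
        ≤⟨ +-mono-≤ (≤-trans (size-mono (N-∪⁅⁆-⊆ I M x)) (size-∪ (N M ∖ I) Y))
                    (≤-trans (weight-∪ w M ⁅ x ⁆) (≤-reflexive (cong (weight w M +_) (weight-⁅⁆ w x)))) ⟩
      (size (N M ∖ I) + size Y) + (weight w M + w x)   ≡⟨ interchange (size (N M ∖ I)) (size Y) (weight w M) (w x) ⟩
      (size (N M ∖ I) + weight w M) + (size Y + w x)   ≤⟨ +-monoˡ-≤ _ (bound (proj₁ candidate)) ⟩
      K * size M + (size Y + w x)                      ∎)
    Y-nonempty : ∀ {a} → K ≤ a + w x → 1 ≤ a
    Y-nonempty {zero}  K≤wx = ⊥-elim (<⇒≱ wx<K K≤wx)
    Y-nonempty {suc a} _    = s≤s z≤n
    y = proj₁ (size≥1⇒∈ Y (Y-nonempty K≤))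
    y∈Y = proj₂ (size≥1⇒∈ Y (Y-nonempty K≤))
    y-free : (I ∪ M ∪ N M) y ≡ false
    y-free = not-injective (∧-conicalˡ _ _ y∈Y)

  -- K|S| − |N(S)|, shifted by n to stay in ℕ
  excess : VSet n → ℕ
  excess S = K * size S + size (∁ (N S))

  initial-expanding : ∃ λ B → size B < m × Expanding B (λ v → χ (B v) * K)
  initial-expanding with maximiser (λ s → size (lookup s) ≤ m + m + m) (λ s → size (lookup s) ≤? m + m + m)
                 (excess ∘ lookup) {tabulate (∅ {n})}
                 (≤-trans (≤-reflexive (trans (size-cong {S = lookup (tabulate (∅ {n}))} {∅} (lookup∘tabulate ∅))
                                              (size-∅ {n}))) z≤n)
  ... | b , B≤ , B-max = B , B<m , record { expand = B-expands }
    where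
    open ≤-Reasoning
    B = lookup b
    trade : ∀ S → size S ≤ m + m + m → K * size S + size (N B) ≤ K * size B + size (N S)
    trade S S≤ = complement-trade (N S) (N B) (begin
      excess S                 ≡⟨ cong₂ _+_ (cong (K *_) (size-cong (lookup∘tabulate S)))
                                            (size-cong λ v → cong not (N-cong (lookup∘tabulate S) v)) ⟨
      excess (lookup (tabulate S)) ≤⟨ B-max (tabulate S) (≤-trans (≤-reflexive (size-cong (lookup∘tabulate S))) S≤) ⟩
      excess B                 ∎)
    NB≤ : size (N B) ≤ K * size B
    NB≤ = begin
      size (N B)                    ≤⟨ m≤n+m _ _ ⟩
      K * size (∅ {n}) + size (N B) ≤⟨ trade ∅ (≤-trans (≤-reflexive (size-∅ {n})) z≤n) ⟩
      K * size B + size (N ∅)       ≡⟨ cong (K * size B +_) (size-empty (N ∅) N-∅) ⟩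
      K * size B + 0                ≡⟨ +-identityʳ _ ⟩
      K * size B                    ∎
    B<m : size B < m
    B<m = few-new-neighbours⇒small {I = ∅} (≤-trans (≤-reflexive (size-∅ {n})) z≤n) NB≤ B≤
    regroup₁ : ∀ K s b nb → K * s + (K * b + nb) ≡ K * (s + b) + nb
    regroup₁ = solve-∀
    regroup₂ : ∀ K u i nb → K * (u + i) + nb ≡ K * u + nb + K * i
    regroup₂ = solve-∀
    regroup₃ : ∀ Kb nb ns Ki → Kb + (nb + ns) + Ki ≡ ns + Ki + (Kb + nb)
    regroup₃ = solve-∀
    B-expands : ∀ S → size S ≤ m + m → K * size S ≤ size (N S ∖ B) + weight (λ v → χ (B v) * K) S
    B-expands S S≤ = +-cancelʳ-≤ (K * size B + size (N B)) _ _ (begin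
      K * size S + (K * size B + size (N B))                   ≡⟨ regroup₁ K (size S) (size B) (size (N B)) ⟩
      K * (size S + size B) + size (N B)                       ≡⟨ cong (λ z → K * z + size (N B)) (size-∪-∩ S B) ⟨
      K * (size (S ∪ B) + size (S ∩ B)) + size (N B)
        ≡⟨ regroup₂ K (size (S ∪ B)) (size (S ∩ B)) (size (N B)) ⟩
      K * size (S ∪ B) + size (N B) + K * size (S ∩ B)         ≤⟨ +-monoˡ-≤ _ (trade (S ∪ B) U≤) ⟩
      K * size B + size (N (S ∪ B)) + K * size (S ∩ B)
        ≤⟨ +-monoˡ-≤ (K * size (S ∩ B)) (+-monoʳ-≤ (K * size B) NU≤) ⟩
      K * size B + (size (N B) + size (N S ∖ B)) + K * size (S ∩ B)
        ≡⟨ regroup₃ (K * size B) (size (N B)) (size (N S ∖ B)) (K * size (S ∩ B)) ⟩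
      size (N S ∖ B) + K * size (S ∩ B) + (K * size B + size (N B))
        ≡⟨ cong (λ z → size (N S ∖ B) + z + (K * size B + size (N B))) (weight-χ* K B S) ⟨
      size (N S ∖ B) + weight (λ v → χ (B v) * K) S + (K * size B + size (N B)) ∎)
      where
      U≤ = ≤-trans (size-∪ S B) (+-mono-≤ S≤ (<⇒≤ B<m))
      NU≤ = ≤-trans (size-mono (N-∪-⊆ S B)) (size-∪ (N B) (N S ∖ B))

  expanding⇒new-neighbours : ∀ {I w S} → Expanding I w → size S ≤ m + m → (∀ v → S v ≡ true → w v ≤ D) →
    D * size S ≤ size (N S ∖ I)
  expanding⇒new-neighbours {I} {w} {S} I-expanding S≤ w≤D = +-cancelʳ-≤ (D * size S) _ _ (begin
    D * size S + D * size S          ≡⟨ *-distribʳ-+ (size S) D D ⟨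
    K * size S                       ≤⟨ expand I-expanding S S≤ ⟩
    size (N S ∖ I) + weight w S      ≤⟨ +-monoʳ-≤ _ (≤-trans (weight-≤ w S w≤D) (≤-reflexive (*-comm (size S) D))) ⟩
    size (N S ∖ I) + D * size S      ∎)
    where open ≤-Reasoning

-- Leaves of forests

module _ {t : ℕ} (T : Graph t) where

  LeafIn : VSet t → Fin t → Set
  LeafIn A v = A v ≡ true × (∀ {u u'} → A u ≡ true → A u' ≡ true → Edge T v u → Edge T v u' → u ≡ u')

  Branching : VSet t → Set
  Branching A = ∀ v → A v ≡ true →
    ∃₂ λ u u' → u ≢ u' × A u ≡ true × A u' ≡ true × Edge T v u × Edge T v u'

  module NonBacktrackingWalk (A : VSet t) (branching : Branching A) {a} (Aa : A a ≡ true) where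

    record Step : Set where
      constructor step
      field
        prev cur : Fin t
        cur∈A    : A cur ≡ true
        edge     : Edge T prev cur

    forward : ∀ p c → A c ≡ true → Σ (Fin t) λ c' → c' ≢ p × A c' ≡ true × Edge T c c'
    forward p c Ac with branching c Ac
    ... | u , u' , u≢u' , Au , Au' , cu , cu' with u ≟ p
    ...   | yes refl = u' , u≢u' ∘ sym , Au' , cu'
    ...   | no u≢p   = u , u≢p , Au , cu

    advance : Step → Step
    advance (step p c Ac _) = let c' , _ , Ac' , cc' = forward p c Ac in step c c' Ac' cc'

    walk : ℕ → Step
    walk zero    = let u , _ , _ , Au , _ , au , _ = branching a Aa in step a u Au au
    walk (suc k) = advance (walk k)

    w : ℕ → Fin t
    w = Step.prev ∘ walk

    w-edge : ∀ k → Edge T (w k) (w (suc k))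
    w-edge = Step.edge ∘ walk

    w-no-backtrack : ∀ k → w (suc (suc k)) ≢ w k
    w-no-backtrack k = proj₁ (proj₂ (forward (w k) (w (suc k)) (Step.cur∈A (walk k))))

    Distinct : ℕ → Set
    Distinct j = ∀ {x y} → x < j → y < j → w x ≡ w y → x ≡ y

    FirstRepeat : Set
    FirstRepeat = Σ ℕ λ j → Σ ℕ λ i → i < j × w i ≡ w j × Distinct j

    distinct-or-repeat : ∀ j → Distinct (suc j) ⊎ FirstRepeat
    distinct-or-repeat zero = inj₁ λ { (s≤s z≤n) (s≤s z≤n) _ → refl }
    distinct-or-repeat (suc j) with distinct-or-repeat j
    ... | inj₂ repeat = inj₂ repeat
    ... | inj₁ distinct with anyUpTo? (λ i → w i ≟ w (suc j)) (suc j)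
    ...   | yes (i , i<j , wi≡wj) = inj₂ (suc j , i , i<j , wi≡wj , distinct)
    ...   | no ¬earlier = inj₁ distinct'
      where
      distinct' : Distinct (suc (suc j))
      distinct' {x} {y} x< y< wx≡wy with m≤n⇒m<n∨m≡n (≤-pred x<) | m≤n⇒m<n∨m≡n (≤-pred y<)
      ... | inj₁ x≤j   | inj₁ y≤j   = distinct x≤j y≤j wx≡wy
      ... | inj₂ refl  | inj₁ y≤j   = ⊥-elim (¬earlier (y , y≤j , sym wx≡wy))
      ... | inj₁ x≤j   | inj₂ refl  = ⊥-elim (¬earlier (x , x≤j , wx≡wy))
      ... | inj₂ refl  | inj₂ refl  = refl

    ¬distinct : ¬ Distinct (suc t)
    ¬distinct distinct with pigeonhole (n<1+n t) (w ∘ toℕ)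
    ... | i , j , i<j , e = <-irrefl (distinct (toℕ<n i) (toℕ<n j) e) i<j

    repeat⇒cycle : FirstRepeat → HasCycle T
    repeat⇒cycle (j , i , i<j , wi≡wj , distinct) with m≤n⇒∃[o]m+o≡n i<j
    ... | zero , refl = ⊥-elim (true≢false (trans (sym (w-edge i)) (trans (cong (adj T (w i)) (sym wi≡wj')) (irrefl T (w i)))))
      where wi≡wj' = trans wi≡wj (cong w (+-identityʳ (suc i)))
    ... | suc zero , refl = ⊥-elim (w-no-backtrack i (sym (trans wi≡wj (cong w (+-comm (suc i) 1)))))
    ... | suc (suc k) , refl = k , c , c-injective , c-edge , c-closed
      where
      c : Fin (3 + k) → Fin t
      c x = w (i + toℕ x)
      c-injective : ∀ {x y} → c x ≡ c y → x ≡ y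
      c-injective {x} {y} e = toℕ-injective (+-cancelˡ-≡ i _ _ (distinct (in-range x) (in-range y) e))
        where
        in-range : ∀ x → i + toℕ x < suc i + suc (suc k)
        in-range x = ≤-trans (+-monoʳ-< i (toℕ<n x)) (≤-reflexive (+-suc i (2 + k)))
      c-edge : ∀ (x : Fin (2 + k)) → Edge T (c (inject₁ x)) (c (suc x))
      c-edge x = subst₂ (Edge T) (cong (w ∘ (i +_)) (sym (toℕ-inject₁ x))) (cong w (sym (+-suc i (toℕ x))))
        (w-edge (i + toℕ x))
      c-closed : Edge T (c (fromℕ (2 + k))) (c zero)
      c-closed = subst₂ (Edge T) (cong (w ∘ (i +_)) (sym (toℕ-fromℕ (2 + k))))
        (trans (sym wi≡wj) (cong w (sym (+-identityʳ i)))) (w-edge (i + (2 + k)))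

  fork : VSet t → Fin t → Fin t → Fin t → Bool
  fork A v u u' = not (⁅ u ⁆ u') ∧ A u ∧ A u' ∧ adj T v u ∧ adj T v u'

  branches : VSet t → Fin t → Bool
  branches A v = anyFin λ u → anyFin (fork A v u)

  ¬branches⇒leaf : ∀ A {v} → A v ∧ not (branches A v) ≡ true → LeafIn A v
  ¬branches⇒leaf A {v} leaf = Av , unique
    where
    Av = proj₁ (∧-true leaf)
    unique : ∀ {u u'} → A u ≡ true → A u' ≡ true → Edge T v u → Edge T v u' → u ≡ u'
    unique {u} {u'} Au Au' vu vu' with u ≟ u'
    ... | yes u≡u' = u≡u'
    ... | no u≢u' = ⊥-elim (true≢false (trans (sym fork-found) (not-injective (proj₂ (∧-true leaf)))))
      where
      fork-found : branches A v ≡ true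
      fork-found = anyFin-intro _ u (anyFin-intro (fork A v u) u'
        (cong₂ _∧_ (cong not (⁅⁆-≢ u≢u')) (cong₂ _∧_ Au (cong₂ _∧_ Au' (cong₂ _∧_ vu vu')))))

  branches⇒branching : ∀ A → (∀ v → A v ≡ true → branches A v ≡ true) → Branching A
  branches⇒branching A all-branch v Av with anyFin-elim _ (all-branch v Av)
  ... | u , u-fork with anyFin-elim _ u-fork
  ...   | u' , f with ∧-true f
  ...     | u≢u' , rest with ∧-true rest
  ...       | Au , rest' with ∧-true rest'
  ...         | Au' , rest'' with ∧-true rest''
  ...           | vu , vu' = u , u' , distinct u≢u' , Au , Au' , vu , vu'
    where
    distinct : not (⁅ u ⁆ u') ≡ true → u ≢ u'
    distinct ne refl = true≢false (sym (trans (sym (cong not (⁅⁆-refl u))) ne))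

  branching⇒cycle : ∀ A → Branching A → ∀ {a} → A a ≡ true → HasCycle T
  branching⇒cycle A branching Aa with NonBacktrackingWalk.distinct-or-repeat A branching Aa t
  ... | inj₁ distinct = ⊥-elim (NonBacktrackingWalk.¬distinct A branching Aa distinct)
  ... | inj₂ repeat   = NonBacktrackingWalk.repeat⇒cycle A branching Aa repeat

  forest-leaf : IsForest T → ∀ A {a} → A a ≡ true → ∃ (LeafIn A)
  forest-leaf forest A {a} Aa with anyFin (λ v → A v ∧ not (branches A v)) in e
  ... | true  = let v , leaf = anyFin-elim _ e in v , ¬branches⇒leaf A leaf
  ... | false = ⊥-elim (forest (branching⇒cycle A (branches⇒branching A all-branch) Aa))
    where
    all-branch : ∀ v → A v ≡ true → branches A v ≡ true
    all-branch v Av with branches A v in b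
    ... | true  = refl
    ... | false = sym (trans (sym (cong₂ _∧_ Av (cong not b))) (anyFin≡false⇒ (λ v → A v ∧ not (branches A v)) e v))

-- Greedy embedding

module GreedyEmbedding {t n : ℕ} (T : Graph t) (forest : IsForest T) (G : Graph n) (D m m₂ : ℕ)
  (1≤D : 1 ≤ D) (1≤m : 1 ≤ m) (T-degree : ∀ u → size (adj T u) ≤ D)
  (n-large : t + 13 * D * m + m₂ ≤ n) (dominating : Neighbourhood.AlmostDominating G m m₂) where
  open Neighbourhood G
  open Expansion G t D m m₂ 1≤D 1≤m n-large dominating

  missing : VSet t → Fin t → ℕ
  missing A u = size (adj T u ∖ A)

  record GoodEmbedding (A : VSet t) : Set where
    field
      φ           : Fin t → Fin n
      used        : VSet n
      wt          : Fin n → ℕ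
      φ-injective : ∀ {u u'} → A u ≡ true → A u' ≡ true → φ u ≡ φ u' → u ≡ u'
      φ-edge      : ∀ {u u'} → A u ≡ true → A u' ≡ true → Edge T u u' → Edge G (φ u) (φ u')
      φ-used      : ∀ {u} → A u ≡ true → used (φ u) ≡ true
      wt-unused   : ∀ {v} → used v ≡ false → wt v ≡ 0
      wt-budget   : ∀ {u} → A u ≡ true → wt (φ u) + missing A u ≤ D
      used-size   : size used < size A + m
      expanding   : Expanding used wt

  t≤n : t ≤ n
  t≤n = ≤-trans (≤-trans (m≤m+n t (13 * D * m)) (m≤m+n _ m₂)) n-large

  empty-embedding : ∀ A → (∀ u → A u ≡ false) → GoodEmbedding A
  empty-embedding A none = record
    { φ = λ u → inject≤ u t≤n ; used = B ; wt = λ v → χ (B v) * K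
    ; φ-injective = λ Au → ⊥-elim (absurd Au) ; φ-edge = λ Au → ⊥-elim (absurd Au)
    ; φ-used = λ Au → ⊥-elim (absurd Au) ; wt-unused = λ B∌v → cong (λ b → χ b * K) B∌v
    ; wt-budget = λ Au → ⊥-elim (absurd Au)
    ; used-size = subst (λ a → size B < a + m) (sym (size-empty A none)) B<m
    ; expanding = B-expanding }
    where
    B = proj₁ initial-expanding
    B<m = proj₁ (proj₂ initial-expanding)
    B-expanding = proj₂ (proj₂ initial-expanding)
    absurd : ∀ {u} → A u ≡ true → ⊥
    absurd {u} Au = true≢false (trans (sym Au) (none u))

  module Extension (A : VSet t) (v : Fin t) (leaf : LeafIn T A v) (good : GoodEmbedding (A ∖ ⁅ v ⁆)) where
    open GoodEmbedding good

    A' : VSet t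
    A' = A ∖ ⁅ v ⁆

    Av : A v ≡ true
    Av = proj₁ leaf

    A'∌v : A' v ≡ false
    A'∌v = cong (λ b → not b ∧ A v) (⁅⁆-refl v)

    A'⊆A : A' ⊆ A
    A'⊆A u = ∧-conicalʳ _ _

    split : ∀ {u} → A u ≡ true → v ≡ u ⊎ (v ≢ u × A' u ≡ true)
    split {u} Au with v ≟ u
    ... | yes v≡u = inj₁ v≡u
    ... | no v≢u  = inj₂ (v≢u , Au)

    φ' : Fin n → Fin t → Fin n
    φ' y u = if ⁅ v ⁆ u then y else φ u

    φ'-v : ∀ y → φ' y v ≡ y
    φ'-v y = cong (if_then y else φ v) (⁅⁆-refl v)

    φ'-other : ∀ y {u} → v ≢ u → φ' y u ≡ φ u
    φ'-other y v≢u = cong (if_then y else _) (⁅⁆-≢ v≢u)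

    size-A : size A ≡ suc (size A')
    size-A = size-∖⁅⁆ A Av

    used+2≤ : size used + 2 ≤ t + m
    used+2≤ = begin
      size used + 2       ≡⟨ +-comm (size used) 2 ⟩
      suc (suc (size used)) ≤⟨ s≤s used-size ⟩
      suc (size A' + m)   ≡⟨ cong (_+ m) size-A ⟨
      size A + m          ≤⟨ +-monoˡ-≤ m (size-≤ A) ⟩
      t + m               ∎
      where open ≤-Reasoning

    used-≢ : ∀ {a b} → used a ≡ true → used b ≡ false → a ≢ b
    used-≢ ua ub a≡b = true≢false (trans (sym ua) (trans (cong used a≡b) ub))

    module Place (y : Fin n) (y-unused : used y ≡ false) (wt' : Fin n → ℕ)
      (expanding' : Expanding (used ∪ ⁅ y ⁆) wt')
      (wt'-unused : ∀ {z} → (used ∪ ⁅ y ⁆) z ≡ false → wt' z ≡ 0)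
      (wt'-budget : ∀ {u} → A u ≡ true → wt' (φ' y u) + missing A u ≤ D)
      (y-edge : ∀ {u} → A' u ≡ true → Edge T v u → Edge G y (φ u)) where

      y≢φ : ∀ {u} → A' u ≡ true → y ≢ φ u
      y≢φ A'u = used-≢ (φ-used A'u) y-unused ∘ sym

      φ'-injective : ∀ {u u'} → A u ≡ true → A u' ≡ true → φ' y u ≡ φ' y u' → u ≡ u'
      φ'-injective Au Au' e with split Au | split Au'
      ... | inj₁ refl | inj₁ refl = refl
      ... | inj₁ refl | inj₂ (v≢u' , A'u') = ⊥-elim (y≢φ A'u' (trans (sym (φ'-v y)) (trans e (φ'-other y v≢u'))))
      ... | inj₂ (v≢u , A'u) | inj₁ refl = ⊥-elim (y≢φ A'u (trans (sym (φ'-v y)) (trans (sym e) (φ'-other y v≢u))))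
      ... | inj₂ (v≢u , A'u) | inj₂ (v≢u' , A'u') =
        φ-injective A'u A'u' (trans (sym (φ'-other y v≢u)) (trans e (φ'-other y v≢u')))

      φ'-edge : ∀ {u u'} → A u ≡ true → A u' ≡ true → Edge T u u' → Edge G (φ' y u) (φ' y u')
      φ'-edge {u} Au Au' uu' with split Au | split Au'
      ... | inj₁ refl | inj₁ refl = ⊥-elim (true≢false (trans (sym uu') (irrefl T u)))
      ... | inj₁ refl | inj₂ (v≢u' , A'u') =
        subst₂ (Edge G) (sym (φ'-v y)) (sym (φ'-other y v≢u')) (y-edge A'u' uu')
      ... | inj₂ (v≢u , A'u) | inj₁ refl =
        subst₂ (Edge G) (sym (φ'-other y v≢u)) (sym (φ'-v y))
          (trans (adj-sym G (φ u) y) (y-edge A'u (trans (adj-sym T v u) uu')))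
      ... | inj₂ (v≢u , A'u) | inj₂ (v≢u' , A'u') =
        subst₂ (Edge G) (sym (φ'-other y v≢u)) (sym (φ'-other y v≢u')) (φ-edge A'u A'u' uu')

      φ'-used : ∀ {u} → A u ≡ true → (used ∪ ⁅ y ⁆) (φ' y u) ≡ true
      φ'-used Au with split Au
      ... | inj₁ refl =
        subst (λ z → (used ∪ ⁅ y ⁆) z ≡ true) (sym (φ'-v y)) (M⊆S∪M {S = used} {⁅ y ⁆} y (⁅⁆-refl y))
      ... | inj₂ (v≢u , A'u) =
        subst (λ z → (used ∪ ⁅ y ⁆) z ≡ true) (sym (φ'-other y v≢u)) (S⊆S∪M {S = used} {⁅ y ⁆} _ (φ-used A'u))

      placed : GoodEmbedding A
      placed = record
        { φ = φ' y ; used = used ∪ ⁅ y ⁆ ; wt = wt'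
        ; φ-injective = φ'-injective ; φ-edge = φ'-edge ; φ-used = φ'-used
        ; wt-unused = wt'-unused ; wt-budget = wt'-budget
        ; used-size = begin-strict
            size (used ∪ ⁅ y ⁆)  ≡⟨ size-∪⁅⁆ used y-unused ⟩
            suc (size used)      <⟨ s≤s used-size ⟩
            suc (size A' + m)    ≡⟨ cong (_+ m) size-A ⟨
            size A + m           ∎
        ; expanding = expanding' }
        where open ≤-Reasoning

    budget-unchanged : ∀ y (w' : Fin n → ℕ) {u} → v ≢ u → A' u ≡ true → w' (φ u) ≡ wt (φ u) →
      w' (φ' y u) + missing A u ≤ D
    budget-unchanged y w' {u} v≢u A'u w'≡wt = begin
      w' (φ' y u) + missing A u   ≡⟨ cong (λ z → w' z + missing A u) (φ'-other y v≢u) ⟩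
      w' (φ u) + missing A u      ≤⟨ +-mono-≤ (≤-reflexive w'≡wt) (size-∖-antitone (adj T u) A'⊆A) ⟩
      wt (φ u) + missing A' u     ≤⟨ wt-budget A'u ⟩
      D                           ∎
      where open ≤-Reasoning

    root-case : (∀ {u} → A' u ≡ true → adj T v u ≡ false) → GoodEmbedding A
    root-case isolated = place (root-step expanding used+2≤)
      where
      place : (∃ λ y → used y ≡ false × Expanding (used ∪ ⁅ y ⁆) wt) → GoodEmbedding A
      place (y , y-unused , expanding') = Place.placed y y-unused wt expanding' wt-unused' budget
        (λ A'u vu → ⊥-elim (true≢false (trans (sym vu) (isolated A'u))))
        where
        wt-unused' : ∀ {z} → (used ∪ ⁅ y ⁆) z ≡ false → wt z ≡ 0
        wt-unused' e = wt-unused (∨-conicalˡ _ _ e)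
        budget : ∀ {u} → A u ≡ true → wt (φ' y u) + missing A u ≤ D
        budget Au with split Au
        ... | inj₁ refl = begin
          wt (φ' y v) + missing A v   ≡⟨ cong (_+ missing A v) (trans (cong wt (φ'-v y)) (wt-unused y-unused)) ⟩
          missing A v                 ≤⟨ size-∖-antitone (adj T v) {A} {∅} (λ _ ()) ⟩
          size (adj T v)              ≤⟨ T-degree v ⟩
          D                           ∎
          where open ≤-Reasoning
        ... | inj₂ (v≢u , A'u) = budget-unchanged y wt v≢u A'u refl

    p-missing : ∀ {p} → A' p ≡ true → Edge T v p → suc (missing A p) ≤ missing A' p
    p-missing {p} A'p vp = size-∖-strictly-antitone (adj T p) A'⊆A (trans (adj-sym T p v) vp) Av A'∌v

    parent-has-room : ∀ {p} → A' p ≡ true → Edge T v p → wt (φ p) < K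
    parent-has-room {p} A'p vp = begin-strict
      wt (φ p)                <⟨ m<m+n (wt (φ p)) (≤-trans (s≤s z≤n) (p-missing A'p vp)) ⟩
      wt (φ p) + missing A' p ≤⟨ wt-budget A'p ⟩
      D                       ≤⟨ m≤m+n D D ⟩
      K                       ∎
      where open ≤-Reasoning

    parent-case : ∀ {p} → A' p ≡ true → Edge T v p → GoodEmbedding A
    parent-case {p} A'p vp = place (leaf-step expanding (≤-trans (m≤m+n _ 2) used+2≤) (parent-has-room A'p vp))
      where
      place : (∃ λ y → used y ≡ false × Edge G (φ p) y ×
                       Expanding (used ∪ ⁅ y ⁆) (λ z → wt z + χ (⁅ φ p ⁆ z))) →
              GoodEmbedding A
      place (y , y-unused , xy , expanding₀) = Place.placed y y-unused wt' expanding' wt'-unused budget y-edge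
        where
        open ≤-Reasoning
        x = φ p
        x-used = φ-used A'p
        wt' : Fin n → ℕ
        wt' z = wt z + χ (⁅ x ⁆ z) + χ (⁅ y ⁆ z)
        expanding' = expanding-mono (λ z → m≤m+n _ _) expanding₀
        wt'-unused : ∀ {z} → (used ∪ ⁅ y ⁆) z ≡ false → wt' z ≡ 0
        wt'-unused {z} e = cong₂ _+_ (cong₂ _+_ (wt-unused z-unused) (cong χ (⁅⁆-≢ (used-≢ x-used z-unused))))
                                     (cong χ (∨-conicalʳ _ _ e))
          where z-unused = ∨-conicalˡ _ _ e
        wt'-φ : ∀ {u} → A' u ≡ true → p ≢ u → wt' (φ u) ≡ wt (φ u)
        wt'-φ {u} A'u p≢u = trans (cong₂ (λ a b → wt (φ u) + χ a + χ b)
            (⁅⁆-≢ (p≢u ∘ φ-injective A'p A'u)) (⁅⁆-≢ (used-≢ (φ-used A'u) y-unused ∘ sym)))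
          (trans (+-identityʳ _) (+-identityʳ _))
        wt'-y : wt' y ≡ 1
        wt'-y = cong₂ _+_ (cong₂ _+_ (wt-unused y-unused) (cong χ (⁅⁆-≢ (used-≢ x-used y-unused))))
                          (cong χ (⁅⁆-refl y))
        wt'-x : wt' x ≡ wt x + 1
        wt'-x = trans (cong₂ (λ a b → wt x + χ a + χ b) (⁅⁆-refl x) (⁅⁆-≢ (used-≢ x-used y-unused ∘ sym)))
                      (+-identityʳ _)
        budget : ∀ {u} → A u ≡ true → wt' (φ' y u) + missing A u ≤ D
        budget {u} Au with split Au
        ... | inj₁ refl = begin
          wt' (φ' y v) + missing A v  ≡⟨ cong (λ z → wt' z + missing A v) (φ'-v y) ⟩
          wt' y + missing A v         ≡⟨ cong (_+ missing A v) wt'-y ⟩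
          suc (missing A v)           ≤⟨ size-∖-strictly-antitone (adj T v) {A} {∅} (λ _ ()) vp (A'⊆A p A'p) refl ⟩
          size (adj T v)              ≤⟨ T-degree v ⟩
          D                           ∎
        ... | inj₂ (v≢u , A'u) with p ≟ u
        ...   | yes refl = begin
          wt' (φ' y p) + missing A p  ≡⟨ cong (λ z → wt' z + missing A p) (φ'-other y v≢u) ⟩
          wt' x + missing A p         ≡⟨ cong (_+ missing A p) wt'-x ⟩
          wt x + 1 + missing A p      ≡⟨ +-assoc (wt x) 1 (missing A p) ⟩
          wt x + suc (missing A p)    ≤⟨ +-monoʳ-≤ (wt x) (p-missing A'p vp) ⟩
          wt x + missing A' p         ≤⟨ wt-budget A'p ⟩
          D                           ∎
        ...   | no p≢u = budget-unchanged y wt' v≢u A'u (wt'-φ A'u p≢u)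
        y-edge : ∀ {u} → A' u ≡ true → Edge T v u → Edge G y (φ u)
        y-edge A'u vu rewrite proj₂ leaf (A'⊆A _ A'u) (A'⊆A p A'p) vu vp = trans (adj-sym G y x) xy

    extended : GoodEmbedding A
    extended with anyFin (λ u → A' u ∧ adj T v u) in e
    ... | true  = let p , f = anyFin-elim (λ u → A' u ∧ adj T v u) e in
                  parent-case (proj₁ (∧-true f)) (proj₂ (∧-true f))
    ... | false = root-case λ {u} A'u →
                  trans (sym (cong (_∧ adj T v u) A'u)) (anyFin≡false⇒ (λ u → A' u ∧ adj T v u) e u)

  embed : ∀ k (A : VSet t) → size A ≡ k → GoodEmbedding A
  embed zero    A A≡0 = empty-embedding A (size≡0⇒∉ A A≡0)
  embed (suc k) A A≡k = Extension.extended A v leaf (embed k (A ∖ ⁅ v ⁆) A'≡k)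
    where
    a∈A = size≥1⇒∈ A (subst (1 ≤_) (sym A≡k) (s≤s z≤n))
    v = proj₁ (forest-leaf T forest A (proj₂ a∈A))
    leaf = proj₂ (forest-leaf T forest A (proj₂ a∈A))
    A'≡k : size (A ∖ ⁅ v ⁆) ≡ k
    A'≡k = ℕₚ.suc-injective (trans (sym (size-∖⁅⁆ A (proj₁ leaf))) A≡k)

  embedding : GoodEmbedding (λ _ → true)
  embedding = embed t (λ _ → true) (size-full _ λ _ → refl)

  open GoodEmbedding embedding

  copy : Embedding T G
  copy = record { map = φ ; injective = φ-injective refl refl ; edges = λ _ _ → φ-edge refl refl }

  copy-expands : ∀ (S : Subset t) → ∣ S ∣ ≤ m → D * ∣ S ∣ ≤ ∣ NbhdOutside copy S ∣
  copy-expands S S≤m = begin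
    D * ∣ S ∣                 ≡⟨ cong (D *_) (trans (size-lookup S) (sym size-φS)) ⟩
    D * size φS               ≤⟨ expanding⇒new-neighbours expanding φS≤ φS-wt ⟩
    size (N φS ∖ used)        ≤⟨ size-mono (N-image∖used⊆ φ used (λ _ → φ-used refl) (lookup S)) ⟩
    size outside              ≡⟨ size-tabulate outside ⟨
    ∣ NbhdOutside copy S ∣     ∎
    where
    open ≤-Reasoning
    φS = image φ (lookup S)
    size-φS : size φS ≡ size (lookup S)
    size-φS = size-image φ (φ-injective refl refl) (lookup S)
    φS≤ : size φS ≤ m + m
    φS≤ = ≤-trans (≤-reflexive (trans size-φS (sym (size-lookup S)))) (≤-trans S≤m (m≤m+n m m))
    φS-wt : ∀ v → φS v ≡ true → wt v ≤ D
    φS-wt v e with anyFin-elim (λ u → lookup S u ∧ ⁅ φ u ⁆ v) e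
    ... | u , Su∧φu≡v =
      subst (λ z → wt z ≤ D) (⁅⁆-sound (proj₂ (∧-true Su∧φu≡v))) (≤-trans (m≤m+n _ _) (wt-budget refl))
    outside : VSet n
    outside v = not (anyFin λ u → ⁅ φ u ⁆ v) ∧ anyFin (λ u → lookup S u ∧ adj G (φ u) v)

corollary3p2 : (Δ m₁ m₂ t n : ℕ) → 1 ≤ Δ → 1 ≤ m₁ → 1 ≤ m₂ →
    (T : Graph t) → IsForest T → MaxDegree≤ T Δ →
    (G : Graph n) → t + 13 * Δ * m₁ + m₂ ≤ n → ¬ ComplementContainsK G m₁ m₂ →
    Σ (Embedding T G) λ f →
      ∀ (S : Subset t) → ∣ S ∣ ≤ m₁ → Δ * ∣ S ∣ ≤ ∣ NbhdOutside f S ∣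
corollary3p2 Δ m₁ m₂ t n 1≤Δ 1≤m₁ _ T forest T-degree G n-large no-K = copy , copy-expands
  where
  open GreedyEmbedding T forest G Δ m₁ m₂ 1≤Δ 1≤m₁
    (λ u → subst (_≤ Δ) (size-tabulate (adj T u)) (T-degree u)) n-large (Neighbourhood.¬K⇒almostDominating G no-K)
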